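{- Let $G=(S,\mathit{Tr},\mathrm{src},\mathrm{tgt},S_0)$ be a transition system with functions $\mathrm{instr}:\mathit{Tr}\to\mathcal{P}(\mathcal{I})$ and $\mathrm{comp}:\mathit{Tr}\to\mathcal{P}(\mathcal{C})$, $\mathrm{instr}(t)\neq\emptyset\neq\mathrm{comp}(t)$, and assume there is $\mathrm{cmp}:\mathcal{I}\to\mathcal{C}$ with $\mathrm{comp}(t)=\{\mathrm{cmp}(I)\mid I\in\mathrm{instr}(t)\}$ for all $t\in\mathit{Tr}$. Then $\mathrm{JI}\preceq\mathrm{JC}$: every path that is J-fair w.r.t. the tasks $\{T_C\mid C\in\mathcal{C}\}$, $T_C=\{t\mid C\in\mathrm{comp}(t)\}$, is J-fair w.r.t. the tasks $\{T_I\mid I\in\mathcal{I}\}$, $T_I=\{t\mid I\in\mathrm{instr}(t)\}$.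
   Context: A transition system is $G=(S,\mathit{Tr},\mathrm{src},\mathrm{tgt},S_0)$ with states, transitions, $\mathrm{src},\mathrm{tgt}:\mathit{Tr}\to S$, initial states. A path is an alternating sequence $s_0t_1s_1t_2\cdots$ of states and transitions, starting with a state, infinite or ending with a state, with $\mathrm{src}(t_i)=s_{i-1}$, $\mathrm{tgt}(t_i)=s_i$. A suffix of $s_0t_1s_1\cdots$ is $s_kt_{k+1}s_{k+1}\cdots$. Write $t\smile u$ iff $\mathrm{comp}(t)\cap\mathrm{comp}(u)=\emptyset$. For a task $T\subseteq\mathit{Tr}$: $T$ is enabled in state $s$ if some $t\in T$ has $\mathrm{src}(t)=s$; $T$ is enabled during a transition $u$ if there is $t\in T$ with $\mathrm{src}(t)=\mathrm{src}(u)$ and $t\smile u$; $T$ is continuously enabled on a path $\pi$ if it is enabled in every state and during every transition of $\pi$; $T$ occurs in $\pi$ if $\pi$ contains a transition of $T$. A path $\pi$ is J-fair w.r.t. a task collection if for every suffix $\pi'$ of $\pi$, each task continuously enabled on $\pi'$ occurs in $\pi'$. $H\preceq F$ means every path satisfying $F$ satisfies $H$. -}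

module Defs where

open import Data.Nat using (ℕ; _<_; _≤_; _+_; _∸_)
open import Data.Unit using (⊤)
open import Data.Empty using (⊥)
open import Data.Product using (Σ; ∃; _×_; _,_)
open import Relation.Binary.PropositionalEquality using (_≡_)

record TS : Set₁ where
  field
    S   : Set
    Tr  : Set
    src : Tr → S
    tgt : Tr → S
    S₀  : S → Set

-- Length of a path: number of transitions, finite or infinite.
data Len : Set where
  fin : ℕ → Len
  inf : Len

-- i is a valid transition index (transitions t₁ t₂ … are indexed 0,1,…)
_<ᴸ_ : ℕ → Len → Set
i <ᴸ fin n = i < n
i <ᴸ inf   = ⊤

-- i is a valid state index (states s₀ s₁ …)
_≤ᴸ_ : ℕ → Len → Set
i ≤ᴸ fin n = i ≤ n
i ≤ᴸ inf   = ⊤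

dropLen : ℕ → Len → Len
dropLen k (fin n) = fin (n ∸ k)
dropLen k inf     = inf

module _ (G : TS) where
  open TS G

  -- A path s₀ t₁ s₁ t₂ …: state i = sᵢ, trans i = t_{i+1}; only indices
  -- within the length are meaningful.
  record Path : Set where
    field
      len   : Len
      state : ℕ → S
      trans : ℕ → Tr
      src-ok : ∀ i → i <ᴸ len → src (trans i) ≡ state i
      tgt-ok : ∀ i → i <ᴸ len → tgt (trans i) ≡ state (i + 1)
  open Path

  suffix : (π : Path) (k : ℕ) → k ≤ᴸ len π → Path
  suffix π k k≤ = record
    { len    = dropLen k (len π)
    ; state  = λ i → state π (k + i)
    ; trans  = λ i → trans π (k + i)
    ; src-ok = λ i i< → src-ok π (k + i) (lemma (len π) k≤ i i<)
    ; tgt-ok = λ i i< → Eq.trans (tgt-ok π (k + i) (lemma (len π) k≤ i i<))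
                          (Eq.cong (state π) (NP.+-assoc k i 1))
    }
    where
      import Relation.Binary.PropositionalEquality as Eq
      import Data.Nat.Properties as NP
      lemma : ∀ l → k ≤ᴸ l → ∀ i → i <ᴸ dropLen k l → (k + i) <ᴸ l
      lemma (fin n) k≤n i i< =
        Eq.subst₂ _<_ (NP.+-comm i k) (NP.m∸n+n≡m k≤n) (NP.+-monoˡ-< k i<)
      lemma inf _ i _ = _

  module _ {C : Set} (comp : Tr → C → Set) where

    _⌣_ : Tr → Tr → Set
    t ⌣ u = ∀ c → comp t c → comp u c → ⊥

    Task : Set₁
    Task = Tr → Set

    EnabledIn : Task → S → Set
    EnabledIn T s = ∃ λ t → T t × src t ≡ s

    EnabledDuring : Task → Tr → Set
    EnabledDuring T u = ∃ λ t → T t × src t ≡ src u × t ⌣ u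

    ContinuouslyEnabled : Task → Path → Set
    ContinuouslyEnabled T π =
      (∀ i → i ≤ᴸ len π → EnabledIn T (state π i)) ×
      (∀ i → i <ᴸ len π → EnabledDuring T (trans π i))

    Occurs : Task → Path → Set
    Occurs T π = ∃ λ i → i <ᴸ len π × T (trans π i)

    JFair : {X : Set} → (X → Task) → Path → Set
    JFair {X} T π = ∀ k (k≤ : k ≤ᴸ len π) (x : X) →
      ContinuouslyEnabled (T x) (suffix π k k≤) → Occurs (T x) (suffix π k k≤)

{-# OPTIONS --safe #-}
module Submission where

-- If T_I is continuously enabled on a suffix, so is the larger task T_cmp(I),
-- which therefore occurs there by JC-fairness, say as transition u. But T_I is
-- enabled during u: some t ∈ T_I with comp(t) ∩ comp(u) = ∅, although
-- cmp(I) lies in both. So T_I is never continuously enabled on a suffix of a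
-- JC-fair path, and the JI condition holds vacuously. Only the inclusion
-- T_I ⊆ T_cmp(I) is used.

open import Defs
open import Data.Product using (∃; _×_; _,_)
open import Data.Empty using (⊥-elim)
open import Function.Bundles using (_⇔_; Equivalence)
open import Relation.Binary.PropositionalEquality using (_≡_; refl)
open import Relation.Nullary using (¬_)

module _ (G : TS) {C : Set} (comp : TS.Tr G → C → Set) where
  _⊆ᵀ_ : Task G comp → Task G comp → Set
  T ⊆ᵀ U = ∀ t → T t → U t

  enabledIn-mono : ∀ {T U s} → T ⊆ᵀ U → EnabledIn G comp T s → EnabledIn G comp U s
  enabledIn-mono T⊆U (t , Tt , src≡) = t , T⊆U t Tt , src≡

  enabledDuring-mono : ∀ {T U u} → T ⊆ᵀ U →
    EnabledDuring G comp T u → EnabledDuring G comp U u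
  enabledDuring-mono T⊆U (t , Tt , src≡ , t⌣u) = t , T⊆U t Tt , src≡ , t⌣u

  continuouslyEnabled-mono : ∀ {T U π} → T ⊆ᵀ U →
    ContinuouslyEnabled G comp T π → ContinuouslyEnabled G comp U π
  continuouslyEnabled-mono T⊆U (inStates , duringTrans) =
    (λ i i≤ → enabledIn-mono T⊆U (inStates i i≤)) ,
    (λ i i< → enabledDuring-mono T⊆U (duringTrans i i<))

  enabledDuring⇒¬comp : ∀ {T u c} → T ⊆ᵀ (λ t → comp t c) →
    EnabledDuring G comp T u → ¬ comp u c
  enabledDuring⇒¬comp {c = c} T⊆Tc (t , Tt , _ , t⌣u) = t⌣u c (T⊆Tc t Tt)

  continuouslyEnabled⇒¬occurs : ∀ {T c π} → T ⊆ᵀ (λ t → comp t c) →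
    ContinuouslyEnabled G comp T π → ¬ Occurs G comp (λ t → comp t c) π
  continuouslyEnabled⇒¬occurs T⊆Tc (_ , duringTrans) (j , j< , occ) =
    enabledDuring⇒¬comp T⊆Tc (duringTrans j j<) occ

proposition14p2 :
    (G : TS) (I C : Set)
    (instr : TS.Tr G → I → Set) (comp : TS.Tr G → C → Set) →
    (∀ t → ∃ λ i → instr t i) → (∀ t → ∃ λ c → comp t c) →
    (cmp : I → C) →
    (∀ t c → comp t c ⇔ (∃ λ i → instr t i × cmp i ≡ c)) →
    (π : Path G) →
    JFair G comp (λ c t → comp t c) π →
    JFair G comp (λ i t → instr t i) π
proposition14p2 G I C instr comp _ _ cmp comp⇔ π fairC k k≤ i enabledI =
  ⊥-elim (continuouslyEnabled⇒¬occurs G comp {π = π′} TI⊆TC enabledI occursC)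
  where
    π′ : Path G
    π′ = suffix G π k k≤

    TI⊆TC : ∀ t → instr t i → comp t (cmp i)
    TI⊆TC t it = Equivalence.from (comp⇔ t (cmp i)) (i , it , refl)

    occursC : Occurs G comp (λ t → comp t (cmp i)) π′
    occursC = fairC k k≤ (cmp i) (continuouslyEnabled-mono G comp {π = π′} TI⊆TC enabledI)
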